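{- Let $H$ be a uniform hypergraph. Then every infection set for $H$ is a zero forcing set for $H$, and $\mathrm{Z}_0(H)\le \mathrm{I}(H)$.
   Context: A $d$-uniform hypergraph $H$ has vertex set $V(H)$ and edge set $E(H)$ consisting of $d$-element subsets of $V(H)$. Zero forcing: initially the vertices of a set $B\subseteq V(H)$ are blue and all others white. Hypergraph color change rule: a set $S$ of $d-1$ distinct vertices (not required to be blue) can change a white vertex $w$ to blue if (i) $S\cup\{w\}\in E(H)$ and (ii) whenever $u$ is a white vertex with $S\cup\{u\}\in E(H)$, then $u=w$. $B$ is a zero forcing set if repeated application of this rule colors every vertex blue; $\mathrm{Z}_0(H)$ is the minimum cardinality of a zero forcing set. Infection: initially the vertices of $B$ are infected and all others uninfected. Infection rule: a nonempty set $S$ of infected vertices can infect all the other vertices of an edge $e$ if (1) $S\subset e$, and (2) for every uninfected vertex $u\notin e$, there is no edge $e'$ with $S\cup\{u\}\subseteq e'$. $B$ is an infection set if repeated application of the infection rule infects every vertex; $\mathrm{I}(H)$ is the minimum cardinality of an infection set. -}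

module Defs where

open import Level using (0ℓ)
open import Data.Nat using (ℕ; _∸_; _≤_)
open import Data.Fin using (Fin)
open import Data.Fin.Subset using (Subset; _∈_; _∉_; _⊆_; _∪_; ⁅_⁆; ∣_∣; ⊤; Nonempty)
import Data.Empty
open import Data.Product using (Σ; ∃; _×_)
open import Relation.Binary.PropositionalEquality using (_≡_)
open import Relation.Binary.Construct.Closure.ReflexiveTransitive using (Star)

record Hypergraph : Set₁ where
  field
    n       : ℕ
    d       : ℕ
    Edge    : Subset n → Set
    uniform : ∀ e → Edge e → ∣ e ∣ ≡ d
open Hypergraph public

module _ (H : Hypergraph) where

  private
    V = Subset (n H)

  Forces : V → V → Fin (n H) → Set
  Forces X S w =
    ∣ S ∣ ≡ d H ∸ 1
    × w ∉ X
    × Edge H (S ∪ ⁅ w ⁆)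
    × (∀ u → u ∉ X → Edge H (S ∪ ⁅ u ⁆) → u ≡ w)

  data ZFStep (X : V) : V → Set where
    force : ∀ S w → Forces X S w → ZFStep X (X ∪ ⁅ w ⁆)

  IsZeroForcingSet : V → Set
  IsZeroForcingSet B = Star ZFStep B ⊤

  Infects : V → V → V → Set
  Infects X S e =
    Nonempty S
    × S ⊆ X
    × Edge H e
    × S ⊆ e
    × (∀ u → u ∉ X → u ∉ e → ∀ e' → Edge H e' → S ∪ ⁅ u ⁆ ⊆ e' → Data.Empty.⊥)

  data InfStep (X : V) : V → Set where
    infect : ∀ S e → Infects X S e → InfStep X (X ∪ e)

  IsInfectionSet : V → Set
  IsInfectionSet B = Star InfStep B ⊤

  IsMinCard : (V → Set) → ℕ → Set
  IsMinCard P k = (∃ λ B → P B × ∣ B ∣ ≡ k) × (∀ B → P B → k ≤ ∣ B ∣)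

  IsZ₀ : ℕ → Set
  IsZ₀ = IsMinCard IsZeroForcingSet

  IsI : ℕ → Set
  IsI = IsMinCard IsInfectionSet

-- Each infection step is simulated by zero forcing steps. If S infects the
-- edge e, then for every white vertex v of e the d-1 set e - v forces v:
-- a second white u ≠ v with (e - v) ∪ {u} an edge either lies in e, making
-- e - v an edge of size d - 1, or lies outside e, and then S ⊆ e - v puts
-- S ∪ {u} into an edge, which the infection rule forbids. The blue set only
-- grows meanwhile, so these forcings can be performed one after another until
-- all of e is blue.
module Submission where

open import Defs
open import Data.Nat using (ℕ; _≤_; suc; _∸_)
open import Data.Nat.Properties using (1+n≢n)
open import Data.Fin using (Fin; _≟_)
open import Data.Fin.Subset
open import Data.Fin.Subset.Properties
open import Data.Bool using (true; false)
open import Data.Vec using (_∷_; here; there)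
open import Data.List using (List; []; _∷_; allFin)
open import Data.List.Membership.Propositional using () renaming (_∈_ to _∈ₗ_)
open import Data.List.Membership.Propositional.Properties using (∈-allFin)
import Data.List.Relation.Unary.Any as Any
open import Data.Product using (_×_; _,_)
open import Data.Sum using ([_,_]′)
open import Data.Empty using (⊥-elim)
open import Function using (id)
open import Level using (Level)
open import Relation.Nullary using (yes; no; ¬_)
open import Relation.Binary.Core using (Rel)
open import Relation.Binary.PropositionalEquality
open import Relation.Binary.Construct.Closure.ReflexiveTransitive using (Star; ε; _◅_; _⋆)

private
  variable
    m : ℕ
    p q : Subset m
    x : Fin m

x∈p⇒suc∣p-x∣≡∣p∣ : x ∈ p → suc ∣ p - x ∣ ≡ ∣ p ∣
x∈p⇒suc∣p-x∣≡∣p∣ {p = true ∷ p}  here        = cong suc (cong ∣_∣ (p─⊥≡p p))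
x∈p⇒suc∣p-x∣≡∣p∣ {p = true ∷ p}  (there x∈p) = cong suc (x∈p⇒suc∣p-x∣≡∣p∣ x∈p)
x∈p⇒suc∣p-x∣≡∣p∣ {p = false ∷ p} (there x∈p) = x∈p⇒suc∣p-x∣≡∣p∣ x∈p

x∈p⇒⁅x⁆⊆p : x ∈ p → ⁅ x ⁆ ⊆ p
x∈p⇒⁅x⁆⊆p {p = p} x∈p y∈⁅x⁆ = subst (_∈ p) (sym (x∈⁅y⁆⇒x≡y _ y∈⁅x⁆)) x∈p

p⊆q⇒p∪q≡q : p ⊆ q → p ∪ q ≡ q
p⊆q⇒p∪q≡q {p = p} {q} p⊆q =
  ⊆-antisym (λ y∈p∪q → [ p⊆q , id ]′ (x∈p∪q⁻ p q y∈p∪q)) (q⊆p∪q p q)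

x∈p⇒p-x∪⁅x⁆≡p : x ∈ p → (p - x) ∪ ⁅ x ⁆ ≡ p
x∈p⇒p-x∪⁅x⁆≡p {x = x} {p} x∈p = ⊆-antisym
  (λ y∈ → [ p─q⊆p p ⁅ x ⁆ , x∈p⇒⁅x⁆⊆p x∈p ]′ (x∈p∪q⁻ (p - x) ⁅ x ⁆ y∈))
  within
  where
  within : p ⊆ (p - x) ∪ ⁅ x ⁆
  within {y} y∈p with y ≟ x
  ... | yes refl = q⊆p∪q (p - x) ⁅ x ⁆ (x∈⁅x⁆ x)
  ... | no y≢x   = p⊆p∪q ⁅ x ⁆ (x∈p∧x≢y⇒x∈p-y y∈p y≢x)

module _ {ℓ : Level} {_⟶_ : Rel (Subset m) ℓ} where

  private
    listed-tail : ∀ {e X Y v} {vs : List (Fin m)} →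
      (∀ {w} → w ∈ e → w ∉ X → w ∈ₗ v ∷ vs) → X ⊆ Y → (v ∈ e → v ∈ Y) →
      ∀ {w} → w ∈ e → w ∉ Y → w ∈ₗ vs
    listed-tail listed X⊆Y v∈Y w∈e w∉Y with listed w∈e (λ w∈X → w∉Y (X⊆Y w∈X))
    ... | Any.here refl   = ⊥-elim (w∉Y (v∈Y w∈e))
    ... | Any.there w∈vs = w∈vs

    grow-by-listed-singletons : ∀ (vs : List (Fin m)) e {X} →
      (∀ {Y v} → X ⊆ Y → v ∈ e → v ∉ Y → Y ⟶ (Y ∪ ⁅ v ⁆)) →
      (∀ {w} → w ∈ e → w ∉ X → w ∈ₗ vs) →
      Star _⟶_ X (X ∪ e)
    grow-by-listed-singletons [] e {X} step listed =
      subst (Star _⟶_ X) (sym (trans (∪-comm X e) (p⊆q⇒p∪q≡q e⊆X))) ε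
      where
      e⊆X : e ⊆ X
      e⊆X {w} w∈e with w ∈? X
      ... | yes w∈X = w∈X
      ... | no w∉X with listed w∈e w∉X
      ...   | ()
    grow-by-listed-singletons (v ∷ vs) e {X} step listed with v ∈? e | v ∈? X
    ... | yes v∈e | no v∉X =
      step ⊆-refl v∈e v∉X ◅ subst (Star _⟶_ (X ∪ ⁅ v ⁆)) absorbed
        (grow-by-listed-singletons vs e
          (λ X∪v⊆Y → step (⊆-trans (p⊆p∪q ⁅ v ⁆) X∪v⊆Y))
          (listed-tail listed (p⊆p∪q ⁅ v ⁆) (λ _ → q⊆p∪q X ⁅ v ⁆ (x∈⁅x⁆ v))))
      where
      open ≡-Reasoning
      absorbed : (X ∪ ⁅ v ⁆) ∪ e ≡ X ∪ e
      absorbed = begin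
        (X ∪ ⁅ v ⁆) ∪ e ≡⟨ ∪-assoc X ⁅ v ⁆ e ⟩
        X ∪ (⁅ v ⁆ ∪ e) ≡⟨ cong (X ∪_) (p⊆q⇒p∪q≡q (x∈p⇒⁅x⁆⊆p v∈e)) ⟩
        X ∪ e           ∎
    ... | yes _   | yes v∈X = grow-by-listed-singletons vs e step (listed-tail listed ⊆-refl (λ _ → v∈X))
    ... | no v∉e  | _       = grow-by-listed-singletons vs e step (listed-tail listed ⊆-refl (λ v∈e → ⊥-elim (v∉e v∈e)))

  grow-by-singletons : ∀ e {X} →
    (∀ {Y v} → X ⊆ Y → v ∈ e → v ∉ Y → Y ⟶ (Y ∪ ⁅ v ⁆)) →
    Star _⟶_ X (X ∪ e)
  grow-by-singletons e step = grow-by-listed-singletons (allFin _) e step (λ {w} _ _ → ∈-allFin w)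

module _ (H : Hypergraph) where

  edge-minus-vertex-not-edge : ∀ {e v} → Edge H e → v ∈ e → ¬ Edge H (e - v)
  edge-minus-vertex-not-edge {e} {v} e-edge v∈e e-v-edge = 1+n≢n (begin
    suc ∣ e - v ∣ ≡⟨ x∈p⇒suc∣p-x∣≡∣p∣ v∈e ⟩
    ∣ e ∣         ≡⟨ uniform H e e-edge ⟩
    d H           ≡⟨ uniform H (e - v) e-v-edge ⟨
    ∣ e - v ∣     ∎)
    where open ≡-Reasoning

  infected-edge-forces : ∀ {X Y S e v} → Infects H X S e → X ⊆ Y → v ∈ e → v ∉ Y →
                         Forces H Y (e - v) v
  infected-edge-forces {X} {Y} {S} {e} {v} (_ , S⊆X , e-edge , S⊆e , no-escape) X⊆Y v∈e v∉Y =
    size , v∉Y , subst (Edge H) (sym (x∈p⇒p-x∪⁅x⁆≡p v∈e)) e-edge , unique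
    where
    size : ∣ e - v ∣ ≡ d H ∸ 1
    size = cong (_∸ 1) (trans (x∈p⇒suc∣p-x∣≡∣p∣ v∈e) (uniform H e e-edge))

    S⊆e-v : S ⊆ e - v
    S⊆e-v y∈S = x∈p∧x≢y⇒x∈p-y (S⊆e y∈S) (λ { refl → v∉Y (X⊆Y (S⊆X y∈S)) })

    unique : ∀ u → u ∉ Y → Edge H ((e - v) ∪ ⁅ u ⁆) → u ≡ v
    unique u u∉Y edge with u ≟ v | u ∈? e
    ... | yes u≡v | _       = u≡v
    ... | no u≢v  | yes u∈e =
      ⊥-elim (edge-minus-vertex-not-edge e-edge v∈e
        (subst (Edge H) (trans (∪-comm (e - v) ⁅ u ⁆)
                               (p⊆q⇒p∪q≡q (x∈p⇒⁅x⁆⊆p (x∈p∧x≢y⇒x∈p-y u∈e u≢v)))) edge))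
    ... | no _    | no u∉e  =
      ⊥-elim (no-escape u (λ u∈X → u∉Y (X⊆Y u∈X)) u∉e _ edge
        (λ y∈ → [ (λ y∈S → p⊆p∪q ⁅ u ⁆ (S⊆e-v y∈S)) , q⊆p∪q (e - v) ⁅ u ⁆ ]′ (x∈p∪q⁻ S ⁅ u ⁆ y∈)))

  infection-step⇒forcing-steps : ∀ {X Y} → InfStep H X Y → Star (ZFStep H) X Y
  infection-step⇒forcing-steps (infect S e infects) = grow-by-singletons e
    (λ {_} {v} X⊆Y v∈e v∉Y → force (e - v) v (infected-edge-forces infects X⊆Y v∈e v∉Y))

  infectionSet⇒zeroForcingSet : ∀ B → IsInfectionSet H B → IsZeroForcingSet H B
  infectionSet⇒zeroForcingSet B = infection-step⇒forcing-steps ⋆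

theorem2p1 : (H : Hypergraph) →
    (∀ (B : Subset (n H)) → IsInfectionSet H B → IsZeroForcingSet H B)
    × (∀ (z i : ℕ) → IsZ₀ H z → IsI H i → z ≤ i)
theorem2p1 H = infectionSet⇒zeroForcingSet H , Z₀≤I
  where
  Z₀≤I : ∀ z i → IsZ₀ H z → IsI H i → z ≤ i
  Z₀≤I z i (_ , z-minimal) ((B , infection , refl) , _) =
    z-minimal B (infectionSet⇒zeroForcingSet H B infection)
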